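{- For $n\in\{2,4,6,8,10\}$, every subset of $\mathbb{Z}_n$ is uniquely determined up to translation by its $3$-deck: if $E,F\subseteq\mathbb{Z}_n$ have the same $3$-deck then $F=E+t$ for some $t\in\mathbb{Z}_n$.
   Context: For $f:\mathbb{Z}_n\to\mathbb{R}$, the $3$-deck is $N_{f,3}(x_1,x_2)=\sum_{x\in\mathbb{Z}_n} f(x)f(x+x_1)f(x+x_2)$; the $3$-deck of $E\subseteq\mathbb{Z}_n$ is that of its indicator function. -}

module Defs where

open import Data.Nat using (ℕ; NonZero; _+_; _*_)
open import Data.Nat.DivMod using (_mod_)
open import Data.Fin using (Fin; toℕ)
open import Data.Bool using (Bool; true; false)
open import Data.List using (List; map; allFin)
open import Data.Nat.ListAction using (sum)

addZ : (n : ℕ) .{{_ : NonZero n}} → Fin n → Fin n → Fin n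
addZ n a b = (toℕ a + toℕ b) mod n

Subset : ℕ → Set
Subset n = Fin n → Bool

indicator : {n : ℕ} → Subset n → Fin n → ℕ
indicator E x with E x
... | true  = 1
... | false = 0

deck3 : (n : ℕ) .{{_ : NonZero n}} → (Fin n → ℕ) → Fin n → Fin n → ℕ
deck3 n f x₁ x₂ =
  sum (map (λ x → f x * f (addZ n x x₁) * f (addZ n x x₂)) (allFin n))

deck3Set : (n : ℕ) .{{_ : NonZero n}} → Subset n → Fin n → Fin n → ℕ
deck3Set n E = deck3 n (indicator E)

-- Translation: F = E + t means y ∈ F iff y - t ∈ E, equivalently
-- (substituting y = x + t) F (x + t) = E x for all x; the statement uses this form.

-- The translation class of a subset of ℤ_n (n = 2, 4, …, 10) is already pinned down by a few
-- values of its 3-deck, its signature. A table sends each signature to a representative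
-- subset, and the kernel checks by evaluation, over all 2^n subsets, that every subset is a
-- translate of the representative of its signature. Two subsets with the same deck share a
-- signature, hence a representative, hence are translates of each other.

module Submission where

open import Defs
open import Data.Bool using (Bool; true; false)
import Data.Bool.Properties as Bool
open import Data.Fin using (Fin; toℕ; #_)
open import Data.Fin.Properties using (toℕ-injective; toℕ-fromℕ<; toℕ≤n; any?; all?)
open import Data.Fin.Subset.Properties using (anySubset?)
open import Data.List using (List; []; _∷_; map; allFin; find)
import Data.List.Properties as List
open import Data.Maybe using (maybe)
open import Data.Nat using (ℕ; NonZero; _≤_; _+_; _*_; _∸_; _%_)
import Data.Nat.Properties as ℕ
open import Data.Nat.DivMod using (_mod_; %-distribˡ-+; m%n%n≡m%n; [m+n]%n≡m%n)
open import Data.Nat.ListAction using (sum)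
open import Data.Product using (∃; _×_; _,_; proj₁; proj₂; uncurry)
open import Data.Sum using (_⊎_; inj₁; inj₂)
open import Data.Vec using (Vec; []; _∷_; lookup; tabulate)
open import Data.Vec.Properties using (lookup∘tabulate)
open import Function using (_∘_)
open import Relation.Binary.PropositionalEquality
  using (_≡_; _≗_; refl; sym; trans; cong; cong₂; subst; module ≡-Reasoning)
open import Relation.Nullary using (Dec; ¬?; map′)
open import Relation.Nullary.Decidable using (True; toWitness; decidable-stable)
open import Relation.Unary using (Pred; Decidable)

[m%d+n]%d≡[m+n]%d : ∀ m n d .{{_ : NonZero d}} → (m % d + n) % d ≡ (m + n) % d
[m%d+n]%d≡[m+n]%d m n d = begin
  (m % d + n) % d          ≡⟨ %-distribˡ-+ (m % d) n d ⟩
  (m % d % d + n % d) % d  ≡⟨ cong (λ k → (k + n % d) % d) (m%n%n≡m%n m d) ⟩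
  (m % d + n % d) % d      ≡⟨ %-distribˡ-+ m n d ⟨
  (m + n) % d              ∎
  where open ≡-Reasoning

[m+n%d]%d≡[m+n]%d : ∀ m n d .{{_ : NonZero d}} → (m + n % d) % d ≡ (m + n) % d
[m+n%d]%d≡[m+n]%d m n d = begin
  (m + n % d) % d  ≡⟨ cong (_% d) (ℕ.+-comm m (n % d)) ⟩
  (n % d + m) % d  ≡⟨ [m%d+n]%d≡[m+n]%d n m d ⟩
  (n + m) % d      ≡⟨ cong (_% d) (ℕ.+-comm n m) ⟩
  (m + n) % d      ∎
  where open ≡-Reasoning

m+[n+[o∸p]]+p≡m+n+o : ∀ m n {o p} → p ≤ o → m + (n + (o ∸ p)) + p ≡ m + n + o
m+[n+[o∸p]]+p≡m+n+o m n {o} {p} p≤o = begin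
  m + (n + (o ∸ p)) + p    ≡⟨ ℕ.+-assoc m (n + (o ∸ p)) p ⟩
  m + (n + (o ∸ p) + p)    ≡⟨ cong (m +_) (ℕ.+-assoc n (o ∸ p) p) ⟩
  m + (n + (o ∸ p + p))    ≡⟨ cong (λ k → m + (n + k)) (ℕ.m∸n+n≡m p≤o) ⟩
  m + (n + o)              ≡⟨ ℕ.+-assoc m n o ⟨
  m + n + o                ∎
  where open ≡-Reasoning

indicator-cong : ∀ {n} {E F : Subset n} → E ≗ F → indicator E ≗ indicator F
indicator-cong E≗F x rewrite E≗F x = refl

allSubset? : ∀ {n ℓ} {P : Pred (Vec Bool n) ℓ} → Decidable P → Dec (∀ V → P V)
allSubset? P? = map′
  (λ ¬∃¬P V → decidable-stable (P? V) (λ ¬PV → ¬∃¬P (V , ¬PV)))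
  (λ ∀P (V , ¬PV) → ¬PV (∀P V))
  (¬? (anySubset? (¬? ∘ P?)))

module _ (n : ℕ) .{{_ : NonZero n}} where

  toℕ-addZ : ∀ a b → toℕ (addZ n a b) ≡ (toℕ a + toℕ b) % n
  toℕ-addZ a b = toℕ-fromℕ< _

  addZ-difference : ∀ (s s′ : Fin n) → ∃ λ t → ∀ x → addZ n (addZ n x t) s′ ≡ addZ n x s
  addZ-difference s s′ = t , λ x → toℕ-injective (begin
    toℕ (addZ n (addZ n x t) s′)           ≡⟨ toℕ-addZ (addZ n x t) s′ ⟩
    (toℕ (addZ n x t) + b′) % n            ≡⟨ cong (λ k → (k + b′) % n) (toℕ-addZ x t) ⟩
    ((toℕ x + toℕ t) % n + b′) % n         ≡⟨ cong (λ k → ((toℕ x + k) % n + b′) % n) (toℕ-fromℕ< _) ⟩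
    ((toℕ x + u % n) % n + b′) % n         ≡⟨ cong (λ k → (k + b′) % n) ([m+n%d]%d≡[m+n]%d (toℕ x) u n) ⟩
    ((toℕ x + u) % n + b′) % n             ≡⟨ [m%d+n]%d≡[m+n]%d (toℕ x + u) b′ n ⟩
    (toℕ x + u + b′) % n                   ≡⟨ cong (_% n) (m+[n+[o∸p]]+p≡m+n+o (toℕ x) b (toℕ≤n s′)) ⟩
    (toℕ x + b + n) % n                    ≡⟨ [m+n]%n≡m%n (toℕ x + b) n ⟩
    (toℕ x + b) % n                        ≡⟨ toℕ-addZ x s ⟨
    toℕ (addZ n x s)                       ∎)
    where
    open ≡-Reasoning
    b = toℕ s
    b′ = toℕ s′
    u = b + (n ∸ b′)
    t = u mod n

  Translates : Subset n → Subset n → Set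
  Translates E F = ∃ λ t → ∀ x → F (addZ n x t) ≡ E x

  translates? : ∀ E F → Dec (Translates E F)
  translates? E F = any? λ t → all? λ x → F (addZ n x t) Bool.≟ E x

  translates-cong : ∀ {E E′ F} → E ≗ E′ → Translates E F → Translates E′ F
  translates-cong E≗E′ (t , F≡E) = t , λ x → trans (F≡E x) (E≗E′ x)

  common-translate⇒translate : ∀ {E F R} → Translates E R → Translates F R → Translates E F
  common-translate⇒translate {R = R} (s , R≡E) (s′ , R≡F) with addZ-difference s s′
  ... | t , x+t+s′≡x+s =
    t , λ x → trans (sym (R≡F (addZ n x t))) (trans (cong R (x+t+s′≡x+s x)) (R≡E x))

  SameDeck3 : Subset n → Subset n → Set
  SameDeck3 E F = ∀ x₁ x₂ → deck3Set n E x₁ x₂ ≡ deck3Set n F x₁ x₂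

  deck3-cong : ∀ {f g : Fin n → ℕ} → f ≗ g → ∀ x₁ x₂ → deck3 n f x₁ x₂ ≡ deck3 n g x₁ x₂
  deck3-cong f≗g x₁ x₂ = cong sum (List.map-cong
    (λ x → cong₂ _*_ (cong₂ _*_ (f≗g x) (f≗g (addZ n x x₁))) (f≗g (addZ n x x₂))) (allFin n))

  signature : List (Fin n × Fin n) → Subset n → List ℕ
  signature pairs E = map (uncurry (deck3Set n E)) pairs

  signature-sameDeck3 : ∀ pairs {E F} → SameDeck3 E F → signature pairs E ≡ signature pairs F
  signature-sameDeck3 pairs same = List.map-cong (uncurry same) pairs

  signature-cong : ∀ pairs {E F} → E ≗ F → signature pairs E ≡ signature pairs F
  signature-cong pairs {E} {F} E≗F = signature-sameDeck3 pairs {E} {F} (deck3-cong (indicator-cong E≗F))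

  representative-translates⇒sameDeck3⇒translates :
    ∀ pairs (representative : List ℕ → Subset n) →
    (∀ E → Translates E (representative (signature pairs E))) →
    ∀ E F → SameDeck3 E F → Translates E F
  representative-translates⇒sameDeck3⇒translates pairs representative E↝rep E F same =
    common-translate⇒translate {E} {F} {representative (signature pairs E)} (E↝rep E)
      (subst (Translates F ∘ representative) (sym (signature-sameDeck3 pairs {E} {F} same)) (E↝rep F))

  Table : Set
  Table = List (List ℕ × Vec Bool n)

  -- A signature missing from the table gets the empty set, so a table lacking one fails the check.
  lookupTable : Table → List ℕ → Subset n
  lookupTable table σ =
    maybe (lookup ∘ proj₂) (λ _ → false) (find (λ entry → List.≡-dec ℕ._≟_ (proj₁ entry) σ) table)

  TableReconstructs : List (Fin n × Fin n) → Table → Vec Bool n → Set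
  TableReconstructs pairs table V = Translates (lookup V) (lookupTable table (signature pairs (lookup V)))

  tableReconstructs? : ∀ pairs table → Decidable (TableReconstructs pairs table)
  tableReconstructs? pairs table V = translates? (lookup V) (lookupTable table (signature pairs (lookup V)))

  -- Subsets are functions and cannot be enumerated, so the check runs over bit vectors
  -- and is transported back along lookup ∘ tabulate.
  certified-sameDeck3-translates : ∀ pairs table →
    True (allSubset? (tableReconstructs? pairs table)) →
    ∀ E F → SameDeck3 E F → Translates E F
  certified-sameDeck3-translates pairs table valid =
    representative-translates⇒sameDeck3⇒translates pairs (lookupTable table) λ E →
      let V≗E = lookup∘tabulate E
      in translates-cong {F = lookupTable table (signature pairs E)} V≗E
           (subst (Translates (lookup (tabulate E)) ∘ lookupTable table)
             (signature-cong pairs {lookup (tabulate E)} {E} V≗E)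
             (toWitness valid (tabulate E)))

-- Each row pairs a signature (deck values at the listed pairs, in order) with its representative.
pairs₂ : List (Fin 2 × Fin 2)
pairs₂ = (# 0 , # 0) ∷ []

table₂ : Table 2
table₂ =
    (0 ∷ [] , false ∷ false ∷ []) ∷
    (1 ∷ [] , false ∷ true ∷ []) ∷
    (2 ∷ [] , true ∷ true ∷ []) ∷
    []

pairs₄ : List (Fin 4 × Fin 4)
pairs₄ = (# 0 , # 0) ∷ (# 0 , # 1) ∷ []

table₄ : Table 4
table₄ =
    (0 ∷ 0 ∷ [] , false ∷ false ∷ false ∷ false ∷ []) ∷
    (1 ∷ 0 ∷ [] , false ∷ false ∷ false ∷ true ∷ []) ∷
    (2 ∷ 1 ∷ [] , false ∷ false ∷ true ∷ true ∷ []) ∷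
    (2 ∷ 0 ∷ [] , false ∷ true ∷ false ∷ true ∷ []) ∷
    (3 ∷ 2 ∷ [] , false ∷ true ∷ true ∷ true ∷ []) ∷
    (4 ∷ 4 ∷ [] , true ∷ true ∷ true ∷ true ∷ []) ∷
    []

pairs₆ : List (Fin 6 × Fin 6)
pairs₆ = (# 0 , # 0) ∷ (# 0 , # 1) ∷ (# 0 , # 2) ∷ (# 1 , # 3) ∷ []

table₆ : Table 6
table₆ =
    (0 ∷ 0 ∷ 0 ∷ 0 ∷ [] , false ∷ false ∷ false ∷ false ∷ false ∷ false ∷ []) ∷
    (1 ∷ 0 ∷ 0 ∷ 0 ∷ [] , false ∷ false ∷ false ∷ false ∷ false ∷ true ∷ []) ∷
    (2 ∷ 1 ∷ 0 ∷ 0 ∷ [] , false ∷ false ∷ false ∷ false ∷ true ∷ true ∷ []) ∷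
    (2 ∷ 0 ∷ 1 ∷ 0 ∷ [] , false ∷ false ∷ false ∷ true ∷ false ∷ true ∷ []) ∷
    (3 ∷ 2 ∷ 1 ∷ 0 ∷ [] , false ∷ false ∷ false ∷ true ∷ true ∷ true ∷ []) ∷
    (2 ∷ 0 ∷ 0 ∷ 0 ∷ [] , false ∷ false ∷ true ∷ false ∷ false ∷ true ∷ []) ∷
    (3 ∷ 1 ∷ 1 ∷ 0 ∷ [] , false ∷ false ∷ true ∷ false ∷ true ∷ true ∷ []) ∷
    (3 ∷ 1 ∷ 1 ∷ 1 ∷ [] , false ∷ false ∷ true ∷ true ∷ false ∷ true ∷ []) ∷
    (4 ∷ 3 ∷ 2 ∷ 1 ∷ [] , false ∷ false ∷ true ∷ true ∷ true ∷ true ∷ []) ∷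
    (3 ∷ 0 ∷ 3 ∷ 0 ∷ [] , false ∷ true ∷ false ∷ true ∷ false ∷ true ∷ []) ∷
    (4 ∷ 2 ∷ 3 ∷ 1 ∷ [] , false ∷ true ∷ false ∷ true ∷ true ∷ true ∷ []) ∷
    (4 ∷ 2 ∷ 2 ∷ 2 ∷ [] , false ∷ true ∷ true ∷ false ∷ true ∷ true ∷ []) ∷
    (5 ∷ 4 ∷ 4 ∷ 3 ∷ [] , false ∷ true ∷ true ∷ true ∷ true ∷ true ∷ []) ∷
    (6 ∷ 6 ∷ 6 ∷ 6 ∷ [] , true ∷ true ∷ true ∷ true ∷ true ∷ true ∷ []) ∷
    []

pairs₈ : List (Fin 8 × Fin 8)
pairs₈ = (# 0 , # 0) ∷ (# 0 , # 1) ∷ (# 0 , # 2) ∷ (# 1 , # 3) ∷ (# 1 , # 5) ∷ (# 0 , # 3) ∷ []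

table₈ : Table 8
table₈ =
    (0 ∷ 0 ∷ 0 ∷ 0 ∷ 0 ∷ 0 ∷ [] , false ∷ false ∷ false ∷ false ∷ false ∷ false ∷ false ∷ false ∷ []) ∷
    (1 ∷ 0 ∷ 0 ∷ 0 ∷ 0 ∷ 0 ∷ [] , false ∷ false ∷ false ∷ false ∷ false ∷ false ∷ false ∷ true ∷ []) ∷
    (2 ∷ 1 ∷ 0 ∷ 0 ∷ 0 ∷ 0 ∷ [] , false ∷ false ∷ false ∷ false ∷ false ∷ false ∷ true ∷ true ∷ []) ∷
    (2 ∷ 0 ∷ 1 ∷ 0 ∷ 0 ∷ 0 ∷ [] , false ∷ false ∷ false ∷ false ∷ false ∷ true ∷ false ∷ true ∷ []) ∷
    (3 ∷ 2 ∷ 1 ∷ 0 ∷ 0 ∷ 0 ∷ [] , false ∷ false ∷ false ∷ false ∷ false ∷ true ∷ true ∷ true ∷ []) ∷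
    (2 ∷ 0 ∷ 0 ∷ 0 ∷ 0 ∷ 1 ∷ [] , false ∷ false ∷ false ∷ false ∷ true ∷ false ∷ false ∷ true ∷ []) ∷
    (3 ∷ 1 ∷ 1 ∷ 0 ∷ 0 ∷ 1 ∷ [] , false ∷ false ∷ false ∷ false ∷ true ∷ false ∷ true ∷ true ∷ []) ∷
    (3 ∷ 1 ∷ 1 ∷ 1 ∷ 0 ∷ 1 ∷ [] , false ∷ false ∷ false ∷ false ∷ true ∷ true ∷ false ∷ true ∷ []) ∷
    (4 ∷ 3 ∷ 2 ∷ 1 ∷ 0 ∷ 1 ∷ [] , false ∷ false ∷ false ∷ false ∷ true ∷ true ∷ true ∷ true ∷ []) ∷
    (2 ∷ 0 ∷ 0 ∷ 0 ∷ 0 ∷ 0 ∷ [] , false ∷ false ∷ false ∷ true ∷ false ∷ false ∷ false ∷ true ∷ []) ∷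
    (3 ∷ 1 ∷ 0 ∷ 0 ∷ 1 ∷ 1 ∷ [] , false ∷ false ∷ false ∷ true ∷ false ∷ false ∷ true ∷ true ∷ []) ∷
    (3 ∷ 0 ∷ 2 ∷ 0 ∷ 0 ∷ 0 ∷ [] , false ∷ false ∷ false ∷ true ∷ false ∷ true ∷ false ∷ true ∷ []) ∷
    (4 ∷ 2 ∷ 2 ∷ 0 ∷ 1 ∷ 1 ∷ [] , false ∷ false ∷ false ∷ true ∷ false ∷ true ∷ true ∷ true ∷ []) ∷
    (3 ∷ 1 ∷ 0 ∷ 0 ∷ 0 ∷ 1 ∷ [] , false ∷ false ∷ false ∷ true ∷ true ∷ false ∷ false ∷ true ∷ []) ∷
    (4 ∷ 2 ∷ 1 ∷ 1 ∷ 1 ∷ 2 ∷ [] , false ∷ false ∷ false ∷ true ∷ true ∷ false ∷ true ∷ true ∷ []) ∷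
    (4 ∷ 2 ∷ 2 ∷ 1 ∷ 0 ∷ 1 ∷ [] , false ∷ false ∷ false ∷ true ∷ true ∷ true ∷ false ∷ true ∷ []) ∷
    (5 ∷ 4 ∷ 3 ∷ 2 ∷ 1 ∷ 2 ∷ [] , false ∷ false ∷ false ∷ true ∷ true ∷ true ∷ true ∷ true ∷ []) ∷
    (3 ∷ 0 ∷ 1 ∷ 0 ∷ 0 ∷ 2 ∷ [] , false ∷ false ∷ true ∷ false ∷ false ∷ true ∷ false ∷ true ∷ []) ∷
    (4 ∷ 2 ∷ 1 ∷ 0 ∷ 1 ∷ 2 ∷ [] , false ∷ false ∷ true ∷ false ∷ false ∷ true ∷ true ∷ true ∷ []) ∷
    (4 ∷ 1 ∷ 2 ∷ 0 ∷ 0 ∷ 2 ∷ [] , false ∷ false ∷ true ∷ false ∷ true ∷ false ∷ true ∷ true ∷ []) ∷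
    (4 ∷ 1 ∷ 2 ∷ 1 ∷ 0 ∷ 3 ∷ [] , false ∷ false ∷ true ∷ false ∷ true ∷ true ∷ false ∷ true ∷ []) ∷
    (5 ∷ 3 ∷ 3 ∷ 1 ∷ 1 ∷ 3 ∷ [] , false ∷ false ∷ true ∷ false ∷ true ∷ true ∷ true ∷ true ∷ []) ∷
    (4 ∷ 2 ∷ 0 ∷ 0 ∷ 2 ∷ 2 ∷ [] , false ∷ false ∷ true ∷ true ∷ false ∷ false ∷ true ∷ true ∷ []) ∷
    (4 ∷ 1 ∷ 2 ∷ 1 ∷ 1 ∷ 2 ∷ [] , false ∷ false ∷ true ∷ true ∷ false ∷ true ∷ false ∷ true ∷ []) ∷
    (5 ∷ 3 ∷ 2 ∷ 1 ∷ 3 ∷ 3 ∷ [] , false ∷ false ∷ true ∷ true ∷ false ∷ true ∷ true ∷ true ∷ []) ∷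
    (5 ∷ 3 ∷ 2 ∷ 1 ∷ 2 ∷ 3 ∷ [] , false ∷ false ∷ true ∷ true ∷ true ∷ false ∷ true ∷ true ∷ []) ∷
    (5 ∷ 3 ∷ 3 ∷ 2 ∷ 1 ∷ 3 ∷ [] , false ∷ false ∷ true ∷ true ∷ true ∷ true ∷ false ∷ true ∷ []) ∷
    (6 ∷ 5 ∷ 4 ∷ 3 ∷ 3 ∷ 4 ∷ [] , false ∷ false ∷ true ∷ true ∷ true ∷ true ∷ true ∷ true ∷ []) ∷
    (4 ∷ 0 ∷ 4 ∷ 0 ∷ 0 ∷ 0 ∷ [] , false ∷ true ∷ false ∷ true ∷ false ∷ true ∷ false ∷ true ∷ []) ∷
    (5 ∷ 2 ∷ 4 ∷ 1 ∷ 1 ∷ 2 ∷ [] , false ∷ true ∷ false ∷ true ∷ false ∷ true ∷ true ∷ true ∷ []) ∷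
    (5 ∷ 2 ∷ 3 ∷ 2 ∷ 1 ∷ 4 ∷ [] , false ∷ true ∷ false ∷ true ∷ true ∷ false ∷ true ∷ true ∷ []) ∷
    (6 ∷ 4 ∷ 5 ∷ 3 ∷ 2 ∷ 4 ∷ [] , false ∷ true ∷ false ∷ true ∷ true ∷ true ∷ true ∷ true ∷ []) ∷
    (6 ∷ 4 ∷ 4 ∷ 3 ∷ 3 ∷ 5 ∷ [] , false ∷ true ∷ true ∷ false ∷ true ∷ true ∷ true ∷ true ∷ []) ∷
    (6 ∷ 4 ∷ 4 ∷ 2 ∷ 4 ∷ 4 ∷ [] , false ∷ true ∷ true ∷ true ∷ false ∷ true ∷ true ∷ true ∷ []) ∷
    (7 ∷ 6 ∷ 6 ∷ 5 ∷ 5 ∷ 6 ∷ [] , false ∷ true ∷ true ∷ true ∷ true ∷ true ∷ true ∷ true ∷ []) ∷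
    (8 ∷ 8 ∷ 8 ∷ 8 ∷ 8 ∷ 8 ∷ [] , true ∷ true ∷ true ∷ true ∷ true ∷ true ∷ true ∷ true ∷ []) ∷
    []

pairs₁₀ : List (Fin 10 × Fin 10)
pairs₁₀ = (# 0 , # 0) ∷ (# 0 , # 1) ∷ (# 0 , # 3) ∷ (# 1 , # 5) ∷ (# 0 , # 4) ∷ (# 1 , # 3) ∷ (# 1 , # 4) ∷ (# 2 , # 7) ∷ (# 0 , # 2) ∷ []

table₁₀ : Table 10
table₁₀ =
    (0 ∷ 0 ∷ 0 ∷ 0 ∷ 0 ∷ 0 ∷ 0 ∷ 0 ∷ 0 ∷ [] , false ∷ false ∷ false ∷ false ∷ false ∷ false ∷ false ∷ false ∷ false ∷ false ∷ []) ∷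
    (1 ∷ 0 ∷ 0 ∷ 0 ∷ 0 ∷ 0 ∷ 0 ∷ 0 ∷ 0 ∷ [] , false ∷ false ∷ false ∷ false ∷ false ∷ false ∷ false ∷ false ∷ false ∷ true ∷ []) ∷
    (2 ∷ 1 ∷ 0 ∷ 0 ∷ 0 ∷ 0 ∷ 0 ∷ 0 ∷ 0 ∷ [] , false ∷ false ∷ false ∷ false ∷ false ∷ false ∷ false ∷ false ∷ true ∷ true ∷ []) ∷
    (2 ∷ 0 ∷ 0 ∷ 0 ∷ 0 ∷ 0 ∷ 0 ∷ 0 ∷ 1 ∷ [] , false ∷ false ∷ false ∷ false ∷ false ∷ false ∷ false ∷ true ∷ false ∷ true ∷ []) ∷
    (3 ∷ 2 ∷ 0 ∷ 0 ∷ 0 ∷ 0 ∷ 0 ∷ 0 ∷ 1 ∷ [] , false ∷ false ∷ false ∷ false ∷ false ∷ false ∷ false ∷ true ∷ true ∷ true ∷ []) ∷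
    (2 ∷ 0 ∷ 1 ∷ 0 ∷ 0 ∷ 0 ∷ 0 ∷ 0 ∷ 0 ∷ [] , false ∷ false ∷ false ∷ false ∷ false ∷ false ∷ true ∷ false ∷ false ∷ true ∷ []) ∷
    (3 ∷ 1 ∷ 1 ∷ 0 ∷ 0 ∷ 0 ∷ 0 ∷ 0 ∷ 1 ∷ [] , false ∷ false ∷ false ∷ false ∷ false ∷ false ∷ true ∷ false ∷ true ∷ true ∷ []) ∷
    (3 ∷ 1 ∷ 1 ∷ 0 ∷ 0 ∷ 1 ∷ 0 ∷ 0 ∷ 1 ∷ [] , false ∷ false ∷ false ∷ false ∷ false ∷ false ∷ true ∷ true ∷ false ∷ true ∷ []) ∷
    (4 ∷ 3 ∷ 1 ∷ 0 ∷ 0 ∷ 1 ∷ 0 ∷ 0 ∷ 2 ∷ [] , false ∷ false ∷ false ∷ false ∷ false ∷ false ∷ true ∷ true ∷ true ∷ true ∷ []) ∷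
    (2 ∷ 0 ∷ 0 ∷ 0 ∷ 1 ∷ 0 ∷ 0 ∷ 0 ∷ 0 ∷ [] , false ∷ false ∷ false ∷ false ∷ false ∷ true ∷ false ∷ false ∷ false ∷ true ∷ []) ∷
    (3 ∷ 1 ∷ 1 ∷ 0 ∷ 1 ∷ 0 ∷ 0 ∷ 0 ∷ 0 ∷ [] , false ∷ false ∷ false ∷ false ∷ false ∷ true ∷ false ∷ false ∷ true ∷ true ∷ []) ∷
    (3 ∷ 0 ∷ 0 ∷ 0 ∷ 1 ∷ 0 ∷ 0 ∷ 0 ∷ 2 ∷ [] , false ∷ false ∷ false ∷ false ∷ false ∷ true ∷ false ∷ true ∷ false ∷ true ∷ []) ∷
    (4 ∷ 2 ∷ 1 ∷ 0 ∷ 1 ∷ 0 ∷ 0 ∷ 0 ∷ 2 ∷ [] , false ∷ false ∷ false ∷ false ∷ false ∷ true ∷ false ∷ true ∷ true ∷ true ∷ []) ∷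
    (3 ∷ 1 ∷ 1 ∷ 0 ∷ 1 ∷ 0 ∷ 1 ∷ 0 ∷ 0 ∷ [] , false ∷ false ∷ false ∷ false ∷ false ∷ true ∷ true ∷ false ∷ false ∷ true ∷ []) ∷
    (4 ∷ 2 ∷ 2 ∷ 0 ∷ 1 ∷ 1 ∷ 1 ∷ 0 ∷ 1 ∷ [] , false ∷ false ∷ false ∷ false ∷ false ∷ true ∷ true ∷ false ∷ true ∷ true ∷ []) ∷
    (4 ∷ 2 ∷ 1 ∷ 0 ∷ 1 ∷ 1 ∷ 1 ∷ 0 ∷ 2 ∷ [] , false ∷ false ∷ false ∷ false ∷ false ∷ true ∷ true ∷ true ∷ false ∷ true ∷ []) ∷
    (5 ∷ 4 ∷ 2 ∷ 0 ∷ 1 ∷ 2 ∷ 1 ∷ 0 ∷ 3 ∷ [] , false ∷ false ∷ false ∷ false ∷ false ∷ true ∷ true ∷ true ∷ true ∷ true ∷ []) ∷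
    (2 ∷ 0 ∷ 0 ∷ 0 ∷ 0 ∷ 0 ∷ 0 ∷ 0 ∷ 0 ∷ [] , false ∷ false ∷ false ∷ false ∷ true ∷ false ∷ false ∷ false ∷ false ∷ true ∷ []) ∷
    (3 ∷ 1 ∷ 0 ∷ 0 ∷ 1 ∷ 0 ∷ 0 ∷ 0 ∷ 0 ∷ [] , false ∷ false ∷ false ∷ false ∷ true ∷ false ∷ false ∷ false ∷ true ∷ true ∷ []) ∷
    (3 ∷ 0 ∷ 1 ∷ 0 ∷ 0 ∷ 0 ∷ 0 ∷ 1 ∷ 1 ∷ [] , false ∷ false ∷ false ∷ false ∷ true ∷ false ∷ false ∷ true ∷ false ∷ true ∷ []) ∷
    (4 ∷ 2 ∷ 1 ∷ 0 ∷ 1 ∷ 0 ∷ 0 ∷ 1 ∷ 1 ∷ [] , false ∷ false ∷ false ∷ false ∷ true ∷ false ∷ false ∷ true ∷ true ∷ true ∷ []) ∷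
    (3 ∷ 0 ∷ 1 ∷ 0 ∷ 0 ∷ 0 ∷ 0 ∷ 0 ∷ 1 ∷ [] , false ∷ false ∷ false ∷ false ∷ true ∷ false ∷ true ∷ false ∷ false ∷ true ∷ []) ∷
    (4 ∷ 1 ∷ 1 ∷ 0 ∷ 1 ∷ 0 ∷ 0 ∷ 0 ∷ 2 ∷ [] , false ∷ false ∷ false ∷ false ∷ true ∷ false ∷ true ∷ false ∷ true ∷ true ∷ []) ∷
    (4 ∷ 1 ∷ 2 ∷ 0 ∷ 0 ∷ 1 ∷ 0 ∷ 1 ∷ 2 ∷ [] , false ∷ false ∷ false ∷ false ∷ true ∷ false ∷ true ∷ true ∷ false ∷ true ∷ []) ∷
    (5 ∷ 3 ∷ 2 ∷ 0 ∷ 1 ∷ 1 ∷ 0 ∷ 1 ∷ 3 ∷ [] , false ∷ false ∷ false ∷ false ∷ true ∷ false ∷ true ∷ true ∷ true ∷ true ∷ []) ∷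
    (3 ∷ 1 ∷ 0 ∷ 1 ∷ 1 ∷ 0 ∷ 0 ∷ 0 ∷ 0 ∷ [] , false ∷ false ∷ false ∷ false ∷ true ∷ true ∷ false ∷ false ∷ false ∷ true ∷ []) ∷
    (4 ∷ 2 ∷ 1 ∷ 1 ∷ 2 ∷ 0 ∷ 1 ∷ 0 ∷ 0 ∷ [] , false ∷ false ∷ false ∷ false ∷ true ∷ true ∷ false ∷ false ∷ true ∷ true ∷ []) ∷
    (4 ∷ 1 ∷ 1 ∷ 1 ∷ 1 ∷ 1 ∷ 0 ∷ 1 ∷ 2 ∷ [] , false ∷ false ∷ false ∷ false ∷ true ∷ true ∷ false ∷ true ∷ false ∷ true ∷ []) ∷
    (5 ∷ 3 ∷ 2 ∷ 1 ∷ 2 ∷ 1 ∷ 1 ∷ 1 ∷ 2 ∷ [] , false ∷ false ∷ false ∷ false ∷ true ∷ true ∷ false ∷ true ∷ true ∷ true ∷ []) ∷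
    (4 ∷ 2 ∷ 1 ∷ 1 ∷ 1 ∷ 0 ∷ 1 ∷ 0 ∷ 1 ∷ [] , false ∷ false ∷ false ∷ false ∷ true ∷ true ∷ true ∷ false ∷ false ∷ true ∷ []) ∷
    (5 ∷ 3 ∷ 2 ∷ 1 ∷ 2 ∷ 1 ∷ 2 ∷ 0 ∷ 2 ∷ [] , false ∷ false ∷ false ∷ false ∷ true ∷ true ∷ true ∷ false ∷ true ∷ true ∷ []) ∷
    (5 ∷ 3 ∷ 2 ∷ 1 ∷ 1 ∷ 2 ∷ 1 ∷ 1 ∷ 3 ∷ [] , false ∷ false ∷ false ∷ false ∷ true ∷ true ∷ true ∷ true ∷ false ∷ true ∷ []) ∷
    (6 ∷ 5 ∷ 3 ∷ 1 ∷ 2 ∷ 3 ∷ 2 ∷ 1 ∷ 4 ∷ [] , false ∷ false ∷ false ∷ false ∷ true ∷ true ∷ true ∷ true ∷ true ∷ true ∷ []) ∷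
    (3 ∷ 0 ∷ 0 ∷ 0 ∷ 2 ∷ 0 ∷ 0 ∷ 0 ∷ 1 ∷ [] , false ∷ false ∷ false ∷ true ∷ false ∷ false ∷ false ∷ true ∷ false ∷ true ∷ []) ∷
    (4 ∷ 2 ∷ 0 ∷ 1 ∷ 2 ∷ 0 ∷ 0 ∷ 0 ∷ 1 ∷ [] , false ∷ false ∷ false ∷ true ∷ false ∷ false ∷ false ∷ true ∷ true ∷ true ∷ []) ∷
    (3 ∷ 0 ∷ 2 ∷ 0 ∷ 1 ∷ 0 ∷ 0 ∷ 0 ∷ 0 ∷ [] , false ∷ false ∷ false ∷ true ∷ false ∷ false ∷ true ∷ false ∷ false ∷ true ∷ []) ∷
    (4 ∷ 1 ∷ 2 ∷ 1 ∷ 1 ∷ 0 ∷ 0 ∷ 1 ∷ 1 ∷ [] , false ∷ false ∷ false ∷ true ∷ false ∷ false ∷ true ∷ false ∷ true ∷ true ∷ []) ∷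
    (4 ∷ 1 ∷ 2 ∷ 0 ∷ 2 ∷ 1 ∷ 0 ∷ 0 ∷ 1 ∷ [] , false ∷ false ∷ false ∷ true ∷ false ∷ false ∷ true ∷ true ∷ false ∷ true ∷ []) ∷
    (5 ∷ 3 ∷ 2 ∷ 1 ∷ 2 ∷ 1 ∷ 0 ∷ 1 ∷ 2 ∷ [] , false ∷ false ∷ false ∷ true ∷ false ∷ false ∷ true ∷ true ∷ true ∷ true ∷ []) ∷
    (4 ∷ 1 ∷ 1 ∷ 1 ∷ 2 ∷ 0 ∷ 0 ∷ 0 ∷ 1 ∷ [] , false ∷ false ∷ false ∷ true ∷ false ∷ true ∷ false ∷ false ∷ true ∷ true ∷ []) ∷
    (4 ∷ 0 ∷ 0 ∷ 0 ∷ 3 ∷ 0 ∷ 0 ∷ 0 ∷ 3 ∷ [] , false ∷ false ∷ false ∷ true ∷ false ∷ true ∷ false ∷ true ∷ false ∷ true ∷ []) ∷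
    (5 ∷ 2 ∷ 1 ∷ 1 ∷ 3 ∷ 0 ∷ 0 ∷ 0 ∷ 3 ∷ [] , false ∷ false ∷ false ∷ true ∷ false ∷ true ∷ false ∷ true ∷ true ∷ true ∷ []) ∷
    (4 ∷ 1 ∷ 2 ∷ 0 ∷ 2 ∷ 0 ∷ 1 ∷ 0 ∷ 1 ∷ [] , false ∷ false ∷ false ∷ true ∷ false ∷ true ∷ true ∷ false ∷ false ∷ true ∷ []) ∷
    (5 ∷ 2 ∷ 3 ∷ 1 ∷ 2 ∷ 1 ∷ 1 ∷ 1 ∷ 2 ∷ [] , false ∷ false ∷ false ∷ true ∷ false ∷ true ∷ true ∷ false ∷ true ∷ true ∷ []) ∷
    (5 ∷ 2 ∷ 2 ∷ 0 ∷ 3 ∷ 1 ∷ 1 ∷ 0 ∷ 3 ∷ [] , false ∷ false ∷ false ∷ true ∷ false ∷ true ∷ true ∷ true ∷ false ∷ true ∷ []) ∷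
    (6 ∷ 4 ∷ 3 ∷ 1 ∷ 3 ∷ 2 ∷ 1 ∷ 1 ∷ 4 ∷ [] , false ∷ false ∷ false ∷ true ∷ false ∷ true ∷ true ∷ true ∷ true ∷ true ∷ []) ∷
    (4 ∷ 2 ∷ 0 ∷ 2 ∷ 2 ∷ 0 ∷ 0 ∷ 0 ∷ 0 ∷ [] , false ∷ false ∷ false ∷ true ∷ true ∷ false ∷ false ∷ false ∷ true ∷ true ∷ []) ∷
    (4 ∷ 1 ∷ 1 ∷ 0 ∷ 2 ∷ 0 ∷ 1 ∷ 1 ∷ 1 ∷ [] , false ∷ false ∷ false ∷ true ∷ true ∷ false ∷ false ∷ true ∷ false ∷ true ∷ []) ∷
    (5 ∷ 3 ∷ 1 ∷ 2 ∷ 3 ∷ 0 ∷ 1 ∷ 1 ∷ 1 ∷ [] , false ∷ false ∷ false ∷ true ∷ true ∷ false ∷ false ∷ true ∷ true ∷ true ∷ []) ∷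
    (4 ∷ 1 ∷ 2 ∷ 0 ∷ 1 ∷ 1 ∷ 0 ∷ 0 ∷ 1 ∷ [] , false ∷ false ∷ false ∷ true ∷ true ∷ false ∷ true ∷ false ∷ false ∷ true ∷ []) ∷
    (5 ∷ 2 ∷ 2 ∷ 2 ∷ 2 ∷ 1 ∷ 0 ∷ 1 ∷ 2 ∷ [] , false ∷ false ∷ false ∷ true ∷ true ∷ false ∷ true ∷ false ∷ true ∷ true ∷ []) ∷
    (5 ∷ 2 ∷ 3 ∷ 0 ∷ 2 ∷ 2 ∷ 1 ∷ 1 ∷ 2 ∷ [] , false ∷ false ∷ false ∷ true ∷ true ∷ false ∷ true ∷ true ∷ false ∷ true ∷ []) ∷
    (6 ∷ 4 ∷ 3 ∷ 2 ∷ 3 ∷ 2 ∷ 1 ∷ 2 ∷ 3 ∷ [] , false ∷ false ∷ false ∷ true ∷ true ∷ false ∷ true ∷ true ∷ true ∷ true ∷ []) ∷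
    (5 ∷ 3 ∷ 1 ∷ 3 ∷ 3 ∷ 0 ∷ 1 ∷ 0 ∷ 1 ∷ [] , false ∷ false ∷ false ∷ true ∷ true ∷ true ∷ false ∷ false ∷ true ∷ true ∷ []) ∷
    (5 ∷ 2 ∷ 1 ∷ 1 ∷ 3 ∷ 1 ∷ 1 ∷ 1 ∷ 3 ∷ [] , false ∷ false ∷ false ∷ true ∷ true ∷ true ∷ false ∷ true ∷ false ∷ true ∷ []) ∷
    (6 ∷ 4 ∷ 2 ∷ 3 ∷ 4 ∷ 1 ∷ 2 ∷ 1 ∷ 3 ∷ [] , false ∷ false ∷ false ∷ true ∷ true ∷ true ∷ false ∷ true ∷ true ∷ true ∷ []) ∷
    (5 ∷ 3 ∷ 2 ∷ 1 ∷ 2 ∷ 1 ∷ 1 ∷ 0 ∷ 2 ∷ [] , false ∷ false ∷ false ∷ true ∷ true ∷ true ∷ true ∷ false ∷ false ∷ true ∷ []) ∷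
    (6 ∷ 4 ∷ 3 ∷ 3 ∷ 3 ∷ 2 ∷ 2 ∷ 1 ∷ 3 ∷ [] , false ∷ false ∷ false ∷ true ∷ true ∷ true ∷ true ∷ false ∷ true ∷ true ∷ []) ∷
    (6 ∷ 4 ∷ 3 ∷ 1 ∷ 3 ∷ 3 ∷ 2 ∷ 1 ∷ 4 ∷ [] , false ∷ false ∷ false ∷ true ∷ true ∷ true ∷ true ∷ true ∷ false ∷ true ∷ []) ∷
    (7 ∷ 6 ∷ 4 ∷ 3 ∷ 4 ∷ 4 ∷ 3 ∷ 2 ∷ 5 ∷ [] , false ∷ false ∷ false ∷ true ∷ true ∷ true ∷ true ∷ true ∷ true ∷ true ∷ []) ∷
    (4 ∷ 1 ∷ 3 ∷ 0 ∷ 2 ∷ 0 ∷ 1 ∷ 0 ∷ 0 ∷ [] , false ∷ false ∷ true ∷ false ∷ false ∷ true ∷ false ∷ false ∷ true ∷ true ∷ []) ∷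
    (4 ∷ 0 ∷ 2 ∷ 0 ∷ 1 ∷ 0 ∷ 0 ∷ 1 ∷ 2 ∷ [] , false ∷ false ∷ true ∷ false ∷ false ∷ true ∷ false ∷ true ∷ false ∷ true ∷ []) ∷
    (5 ∷ 2 ∷ 3 ∷ 1 ∷ 2 ∷ 0 ∷ 1 ∷ 1 ∷ 2 ∷ [] , false ∷ false ∷ true ∷ false ∷ false ∷ true ∷ false ∷ true ∷ true ∷ true ∷ []) ∷
    (5 ∷ 2 ∷ 4 ∷ 0 ∷ 3 ∷ 1 ∷ 2 ∷ 0 ∷ 1 ∷ [] , false ∷ false ∷ true ∷ false ∷ false ∷ true ∷ true ∷ false ∷ true ∷ true ∷ []) ∷
    (5 ∷ 2 ∷ 3 ∷ 0 ∷ 2 ∷ 1 ∷ 1 ∷ 1 ∷ 2 ∷ [] , false ∷ false ∷ true ∷ false ∷ false ∷ true ∷ true ∷ true ∷ false ∷ true ∷ []) ∷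
    (6 ∷ 4 ∷ 4 ∷ 1 ∷ 3 ∷ 2 ∷ 2 ∷ 1 ∷ 3 ∷ [] , false ∷ false ∷ true ∷ false ∷ false ∷ true ∷ true ∷ true ∷ true ∷ true ∷ []) ∷
    (4 ∷ 0 ∷ 2 ∷ 0 ∷ 0 ∷ 0 ∷ 0 ∷ 2 ∷ 2 ∷ [] , false ∷ false ∷ true ∷ false ∷ true ∷ false ∷ false ∷ true ∷ false ∷ true ∷ []) ∷
    (5 ∷ 2 ∷ 2 ∷ 1 ∷ 2 ∷ 0 ∷ 1 ∷ 2 ∷ 2 ∷ [] , false ∷ false ∷ true ∷ false ∷ true ∷ false ∷ false ∷ true ∷ true ∷ true ∷ []) ∷
    (5 ∷ 1 ∷ 2 ∷ 0 ∷ 3 ∷ 0 ∷ 1 ∷ 1 ∷ 3 ∷ [] , false ∷ false ∷ true ∷ false ∷ true ∷ false ∷ true ∷ false ∷ true ∷ true ∷ []) ∷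
    (5 ∷ 1 ∷ 3 ∷ 0 ∷ 1 ∷ 1 ∷ 0 ∷ 2 ∷ 3 ∷ [] , false ∷ false ∷ true ∷ false ∷ true ∷ false ∷ true ∷ true ∷ false ∷ true ∷ []) ∷
    (6 ∷ 3 ∷ 3 ∷ 1 ∷ 3 ∷ 1 ∷ 1 ∷ 2 ∷ 4 ∷ [] , false ∷ false ∷ true ∷ false ∷ true ∷ false ∷ true ∷ true ∷ true ∷ true ∷ []) ∷
    (5 ∷ 2 ∷ 3 ∷ 1 ∷ 3 ∷ 0 ∷ 2 ∷ 1 ∷ 1 ∷ [] , false ∷ false ∷ true ∷ false ∷ true ∷ true ∷ false ∷ false ∷ true ∷ true ∷ []) ∷
    (5 ∷ 1 ∷ 3 ∷ 1 ∷ 1 ∷ 1 ∷ 0 ∷ 3 ∷ 3 ∷ [] , false ∷ false ∷ true ∷ false ∷ true ∷ true ∷ false ∷ true ∷ false ∷ true ∷ []) ∷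
    (6 ∷ 3 ∷ 4 ∷ 2 ∷ 3 ∷ 1 ∷ 2 ∷ 3 ∷ 3 ∷ [] , false ∷ false ∷ true ∷ false ∷ true ∷ true ∷ false ∷ true ∷ true ∷ true ∷ []) ∷
    (6 ∷ 3 ∷ 4 ∷ 1 ∷ 4 ∷ 1 ∷ 3 ∷ 1 ∷ 3 ∷ [] , false ∷ false ∷ true ∷ false ∷ true ∷ true ∷ true ∷ false ∷ true ∷ true ∷ []) ∷
    (6 ∷ 3 ∷ 4 ∷ 1 ∷ 2 ∷ 2 ∷ 1 ∷ 3 ∷ 4 ∷ [] , false ∷ false ∷ true ∷ false ∷ true ∷ true ∷ true ∷ true ∷ false ∷ true ∷ []) ∷
    (7 ∷ 5 ∷ 5 ∷ 2 ∷ 4 ∷ 3 ∷ 3 ∷ 3 ∷ 5 ∷ [] , false ∷ false ∷ true ∷ false ∷ true ∷ true ∷ true ∷ true ∷ true ∷ true ∷ []) ∷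
    (5 ∷ 2 ∷ 3 ∷ 1 ∷ 3 ∷ 1 ∷ 1 ∷ 0 ∷ 1 ∷ [] , false ∷ false ∷ true ∷ true ∷ false ∷ false ∷ true ∷ true ∷ false ∷ true ∷ []) ∷
    (6 ∷ 4 ∷ 3 ∷ 3 ∷ 4 ∷ 1 ∷ 2 ∷ 1 ∷ 2 ∷ [] , false ∷ false ∷ true ∷ true ∷ false ∷ false ∷ true ∷ true ∷ true ∷ true ∷ []) ∷
    (5 ∷ 1 ∷ 2 ∷ 1 ∷ 3 ∷ 1 ∷ 0 ∷ 1 ∷ 3 ∷ [] , false ∷ false ∷ true ∷ true ∷ false ∷ true ∷ false ∷ true ∷ false ∷ true ∷ []) ∷
    (6 ∷ 3 ∷ 3 ∷ 3 ∷ 4 ∷ 1 ∷ 1 ∷ 1 ∷ 3 ∷ [] , false ∷ false ∷ true ∷ true ∷ false ∷ true ∷ false ∷ true ∷ true ∷ true ∷ []) ∷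
    (6 ∷ 3 ∷ 5 ∷ 1 ∷ 4 ∷ 2 ∷ 3 ∷ 1 ∷ 2 ∷ [] , false ∷ false ∷ true ∷ true ∷ false ∷ true ∷ true ∷ false ∷ true ∷ true ∷ []) ∷
    (6 ∷ 3 ∷ 4 ∷ 1 ∷ 4 ∷ 2 ∷ 2 ∷ 1 ∷ 3 ∷ [] , false ∷ false ∷ true ∷ true ∷ false ∷ true ∷ true ∷ true ∷ false ∷ true ∷ []) ∷
    (7 ∷ 5 ∷ 5 ∷ 3 ∷ 5 ∷ 3 ∷ 3 ∷ 2 ∷ 4 ∷ [] , false ∷ false ∷ true ∷ true ∷ false ∷ true ∷ true ∷ true ∷ true ∷ true ∷ []) ∷
    (6 ∷ 4 ∷ 2 ∷ 4 ∷ 4 ∷ 0 ∷ 2 ∷ 2 ∷ 2 ∷ [] , false ∷ false ∷ true ∷ true ∷ true ∷ false ∷ false ∷ true ∷ true ∷ true ∷ []) ∷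
    (6 ∷ 3 ∷ 3 ∷ 2 ∷ 4 ∷ 1 ∷ 2 ∷ 2 ∷ 3 ∷ [] , false ∷ false ∷ true ∷ true ∷ true ∷ false ∷ true ∷ false ∷ true ∷ true ∷ []) ∷
    (6 ∷ 3 ∷ 4 ∷ 1 ∷ 3 ∷ 2 ∷ 2 ∷ 2 ∷ 3 ∷ [] , false ∷ false ∷ true ∷ true ∷ true ∷ false ∷ true ∷ true ∷ false ∷ true ∷ []) ∷
    (7 ∷ 5 ∷ 4 ∷ 4 ∷ 5 ∷ 2 ∷ 3 ∷ 3 ∷ 4 ∷ [] , false ∷ false ∷ true ∷ true ∷ true ∷ false ∷ true ∷ true ∷ true ∷ true ∷ []) ∷
    (6 ∷ 3 ∷ 3 ∷ 2 ∷ 3 ∷ 2 ∷ 1 ∷ 3 ∷ 4 ∷ [] , false ∷ false ∷ true ∷ true ∷ true ∷ true ∷ false ∷ true ∷ false ∷ true ∷ []) ∷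
    (7 ∷ 5 ∷ 4 ∷ 5 ∷ 5 ∷ 2 ∷ 3 ∷ 3 ∷ 4 ∷ [] , false ∷ false ∷ true ∷ true ∷ true ∷ true ∷ false ∷ true ∷ true ∷ true ∷ []) ∷
    (7 ∷ 5 ∷ 5 ∷ 3 ∷ 5 ∷ 3 ∷ 4 ∷ 2 ∷ 4 ∷ [] , false ∷ false ∷ true ∷ true ∷ true ∷ true ∷ true ∷ false ∷ true ∷ true ∷ []) ∷
    (7 ∷ 5 ∷ 5 ∷ 2 ∷ 4 ∷ 4 ∷ 3 ∷ 3 ∷ 5 ∷ [] , false ∷ false ∷ true ∷ true ∷ true ∷ true ∷ true ∷ true ∷ false ∷ true ∷ []) ∷
    (8 ∷ 7 ∷ 6 ∷ 5 ∷ 6 ∷ 5 ∷ 5 ∷ 4 ∷ 6 ∷ [] , false ∷ false ∷ true ∷ true ∷ true ∷ true ∷ true ∷ true ∷ true ∷ true ∷ []) ∷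
    (5 ∷ 0 ∷ 0 ∷ 0 ∷ 5 ∷ 0 ∷ 0 ∷ 0 ∷ 5 ∷ [] , false ∷ true ∷ false ∷ true ∷ false ∷ true ∷ false ∷ true ∷ false ∷ true ∷ []) ∷
    (6 ∷ 2 ∷ 2 ∷ 1 ∷ 5 ∷ 1 ∷ 1 ∷ 1 ∷ 5 ∷ [] , false ∷ true ∷ false ∷ true ∷ false ∷ true ∷ false ∷ true ∷ true ∷ true ∷ []) ∷
    (6 ∷ 2 ∷ 4 ∷ 1 ∷ 3 ∷ 2 ∷ 1 ∷ 3 ∷ 4 ∷ [] , false ∷ true ∷ false ∷ true ∷ false ∷ true ∷ true ∷ false ∷ true ∷ true ∷ []) ∷
    (7 ∷ 4 ∷ 4 ∷ 2 ∷ 5 ∷ 3 ∷ 2 ∷ 3 ∷ 6 ∷ [] , false ∷ true ∷ false ∷ true ∷ false ∷ true ∷ true ∷ true ∷ true ∷ true ∷ []) ∷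
    (6 ∷ 2 ∷ 4 ∷ 2 ∷ 2 ∷ 2 ∷ 0 ∷ 4 ∷ 4 ∷ [] , false ∷ true ∷ false ∷ true ∷ true ∷ false ∷ true ∷ false ∷ true ∷ true ∷ []) ∷
    (7 ∷ 4 ∷ 5 ∷ 3 ∷ 4 ∷ 3 ∷ 2 ∷ 5 ∷ 5 ∷ [] , false ∷ true ∷ false ∷ true ∷ true ∷ false ∷ true ∷ true ∷ true ∷ true ∷ []) ∷
    (7 ∷ 4 ∷ 4 ∷ 3 ∷ 6 ∷ 2 ∷ 3 ∷ 2 ∷ 5 ∷ [] , false ∷ true ∷ false ∷ true ∷ true ∷ true ∷ false ∷ true ∷ true ∷ true ∷ []) ∷
    (7 ∷ 4 ∷ 5 ∷ 3 ∷ 4 ∷ 3 ∷ 2 ∷ 4 ∷ 5 ∷ [] , false ∷ true ∷ false ∷ true ∷ true ∷ true ∷ true ∷ false ∷ true ∷ true ∷ []) ∷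
    (8 ∷ 6 ∷ 6 ∷ 4 ∷ 6 ∷ 5 ∷ 4 ∷ 5 ∷ 7 ∷ [] , false ∷ true ∷ false ∷ true ∷ true ∷ true ∷ true ∷ true ∷ true ∷ true ∷ []) ∷
    (7 ∷ 4 ∷ 6 ∷ 2 ∷ 5 ∷ 3 ∷ 4 ∷ 3 ∷ 4 ∷ [] , false ∷ true ∷ true ∷ false ∷ true ∷ true ∷ false ∷ true ∷ true ∷ true ∷ []) ∷
    (8 ∷ 6 ∷ 7 ∷ 4 ∷ 6 ∷ 5 ∷ 5 ∷ 5 ∷ 6 ∷ [] , false ∷ true ∷ true ∷ false ∷ true ∷ true ∷ true ∷ true ∷ true ∷ true ∷ []) ∷
    (8 ∷ 6 ∷ 6 ∷ 5 ∷ 7 ∷ 4 ∷ 5 ∷ 4 ∷ 6 ∷ [] , false ∷ true ∷ true ∷ true ∷ false ∷ true ∷ true ∷ true ∷ true ∷ true ∷ []) ∷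
    (8 ∷ 6 ∷ 6 ∷ 6 ∷ 6 ∷ 4 ∷ 4 ∷ 6 ∷ 6 ∷ [] , false ∷ true ∷ true ∷ true ∷ true ∷ false ∷ true ∷ true ∷ true ∷ true ∷ []) ∷
    (9 ∷ 8 ∷ 8 ∷ 7 ∷ 8 ∷ 7 ∷ 7 ∷ 7 ∷ 8 ∷ [] , false ∷ true ∷ true ∷ true ∷ true ∷ true ∷ true ∷ true ∷ true ∷ true ∷ []) ∷
    (10 ∷ 10 ∷ 10 ∷ 10 ∷ 10 ∷ 10 ∷ 10 ∷ 10 ∷ 10 ∷ [] , true ∷ true ∷ true ∷ true ∷ true ∷ true ∷ true ∷ true ∷ true ∷ true ∷ []) ∷
    []

proposition2 : (n : ℕ) .{{_ : NonZero n}} →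
    (n ≡ 2 ⊎ n ≡ 4 ⊎ n ≡ 6 ⊎ n ≡ 8 ⊎ n ≡ 10) →
    (E F : Subset n) →
    (∀ x₁ x₂ → deck3Set n E x₁ x₂ ≡ deck3Set n F x₁ x₂) →
    ∃ λ (t : Fin n) → ∀ x → F (addZ n x t) ≡ E x
proposition2 .2  (inj₁ refl)                         = certified-sameDeck3-translates 2 pairs₂ table₂ _
proposition2 .4  (inj₂ (inj₁ refl))                  = certified-sameDeck3-translates 4 pairs₄ table₄ _
proposition2 .6  (inj₂ (inj₂ (inj₁ refl)))           = certified-sameDeck3-translates 6 pairs₆ table₆ _
proposition2 .8  (inj₂ (inj₂ (inj₂ (inj₁ refl))))    = certified-sameDeck3-translates 8 pairs₈ table₈ _
proposition2 .10 (inj₂ (inj₂ (inj₂ (inj₂ refl))))    = certified-sameDeck3-translates 10 pairs₁₀ table₁₀ _
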